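{- For every permutation $X$ of $[n]$ there exists a permutation $X^R$ of $[n]$ which is a preorder traversal of a binary search tree on $[n]$ (equivalently, $X^R$ avoids $(2,3,1)$) such that $|G_S(X^R)|=|G_S(X)|$, where both split-model Greedy executions start from the same initial tree $T$.
   Context: A sequence avoids $(2,3,1)$ if it has no subsequence order-isomorphic to $(2,3,1)$. For a permutation $X=(x_1,\dots,x_n)$ of $[n]$, $\mathcal T_X$ is the BST obtained by inserting $x_1,\dots,x_n$ in order into an empty tree, and $I_{x_i}$ is the minimal open interval with integer endpoints containing all keys of the subtree of $\mathcal T_X$ rooted at $x_i$. The initial tree $T$ is encoded by a fixed point set in rows $-(n-1),\dots,0$ (standard geometric encoding). Greedy in the split model: for $i=1,\dots,n$, with $\tau(a)$ the last row $<i$ containing a point in column $a$, add $(a,i)$ for every key $a\in I_{x_i}$ such that the closed rectangle with corners $(a,\tau(a))$ and $(x_i,i)$ contains no other point. $G_S(X)$ is the set of points added in rows $1,\dots,n$. -}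

module Defs where

open import Data.Bool using (Bool; true; false; _∧_; _∨_; not; if_then_else_)
open import Data.Nat as ℕ using (ℕ; zero; suc; _+_; _<ᵇ_)
open import Data.Integer as ℤ using (ℤ; +_; -_)
open import Data.List using (List; []; _∷_; _++_; filter; map; foldr; foldl; length)
open import Data.Maybe using (Maybe; just; nothing)
open import Data.Product using (_×_; _,_; proj₁; proj₂)
open import Relation.Nullary.Decidable using (⌊_⌋)

range : ℕ → List ℕ
range zero    = []
range (suc n) = range n ++ (suc n ∷ [])

-- Binary search trees on [n] (used for the initial tree T and for
-- preorder traversals).  A BST on an interval of keys is determined by
-- its shape; keys are assigned by in-order position.

data BT : Set where
  lf : BT
  nd : BT → BT → BT

size : BT → ℕ
size lf       = 0
size (nd l r) = size l + 1 + size r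

-- preorder traversal of the BST of shape t whose keys are o+1,…,o+size t
preorder : ℕ → BT → List ℕ
preorder o lf       = []
preorder o (nd l r) = (o + size l + 1) ∷ (preorder o l ++ preorder (o + size l + 1) r)

-- Geometric points: (column = key, row)

Point : Set
Point = ℕ × ℤ

-- Standard geometric encoding of the initial tree: key a at row -depth(a)
-- (root in row 0, rows between -(n-1) and 0).
initPts : ℕ → ℕ → BT → List Point
initPts o d lf       = []
initPts o d (nd l r) =
  (o + size l + 1 , - (+ d)) ∷ (initPts o (suc d) l ++ initPts (o + size l + 1) (suc d) r)

data Tree : Set where
  leaf : Tree
  node : Tree → ℕ → Tree → Tree

insert : ℕ → Tree → Tree
insert x leaf = node leaf x leaf
insert x (node l k r) with x <ᵇ k | k <ᵇ x
... | true  | _     = node (insert x l) k r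
... | false | true  = node l k (insert x r)
... | false | false = node l k r

buildBST : List ℕ → Tree
buildBST = foldl (λ t x → insert x t) leaf

keys : Tree → List ℕ
keys leaf         = []
keys (node l k r) = keys l ++ (k ∷ keys r)

subtreeAt : ℕ → Tree → Maybe Tree
subtreeAt x leaf = nothing
subtreeAt x (node l k r) with x <ᵇ k | k <ᵇ x
... | true  | _     = subtreeAt x l
... | false | true  = subtreeAt x r
... | false | false = just (node l k r)

-- a ∈ I_x  (I_x = minimal open integer interval containing the keys of
-- the subtree of 𝒯_X rooted at x, i.e. (min - 1, max + 1)):
-- min ≤ a ≤ max.
inI : Tree → ℕ → ℕ → Bool
inI t x a with subtreeAt x t
... | nothing = false
... | just s  = let ks = keys s
                    lo = foldr ℕ._⊓_ x ks
                    hi = foldr ℕ._⊔_ x ks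
                in (lo ℕ.≤ᵇ a) ∧ (a ℕ.≤ᵇ hi)

maxM : ℤ → Maybe ℤ → Maybe ℤ
maxM r nothing  = just r
maxM r (just s) = just (r ℤ.⊔ s)

-- τ(a): last row containing a point in column a (all points of P lie in
-- rows < i when this is used)
tau : List Point → ℕ → Maybe ℤ
tau P a = foldr (λ p m → if ⌊ proj₁ p ℕ.≟ a ⌋ then maxM (proj₂ p) m else m) nothing P

eqPt : Point → Point → Bool
eqPt (c , r) (c' , r') = ⌊ c ℕ.≟ c' ⌋ ∧ ⌊ r ℤ.≟ r' ⌋

inRect : ℕ → ℤ → ℕ → ℤ → Point → Bool
inRect a t x i (c , r) =
  ((a ℕ.⊓ x) ℕ.≤ᵇ c) ∧ (c ℕ.≤ᵇ (a ℕ.⊔ x)) ∧ (t ℤ.≤ᵇ r) ∧ (r ℤ.≤ᵇ i)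

allB : {A : Set} → (A → Bool) → List A → Bool
allB p []       = true
allB p (x ∷ xs) = p x ∧ allB p xs

touched : List Point → ℕ → ℤ → ℕ → Bool
touched P x i a with tau P a
... | nothing = false
... | just t  = allB (λ p → not (inRect a t x i p) ∨ eqPt p (a , t)) P

rowPts : ℕ → Tree → List Point → ℕ → ℕ → List Point
rowPts n 𝒯 P i x =
  map (λ a → (a , + i))
      (filter (λ a → inI 𝒯 x a ∧ touched P x (+ i) a ≟B true) (range n))
  where
    open import Data.Bool.Properties using () renaming (_≟_ to _≟B_)

run : ℕ → Tree → List Point → ℕ → List ℕ → List Point
run n 𝒯 P i []       = []
run n 𝒯 P i (x ∷ xs) = let new = rowPts n 𝒯 P i x
                        in new ++ run n 𝒯 (P ++ new) (suc i) xs

GS : ℕ → BT → List ℕ → List Point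
GS n T X = run n (buildBST X) (initPts 0 0 T) 1 X

-- Greedy in the split model is local: accessing x touches only columns of I_x, and
-- whether column a is touched depends only on the points in the columns between a
-- and x and on the relative order of their rows.  So if x is the root of 𝒯_X with
-- subtrees L and R, then after the access to x (which precedes all others) the run
-- splits into two independent runs, one on the accesses to keys of L restricted to
-- the columns of L, one likewise for R, each seeing the rows of the other only up to
-- an order-preserving relabelling.  By induction on the tree, |G_S(X)| depends only
-- on 𝒯_X and not on the order in which X inserts its keys; the preorder traversal of
-- 𝒯_X inserts the same tree and avoids (2,3,1).

module Submission where

open import Defs
open import Data.Bool using (Bool; true; false; _∧_; _∨_; not; T; if_then_else_)
open import Data.Bool.Properties using (T-≡; T-∧; ⇔→≡) renaming (_≟_ to _≟B_)
open import Data.Empty using (⊥; ⊥-elim)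
open import Data.Integer as ℤ using (ℤ)
import Data.Integer.Properties as ℤP
open import Data.List using (List; []; _∷_; _++_; filter; map; foldl; length; applyUpTo)
import Data.List.Properties as LP
open import Data.List.Membership.Propositional using (_∈_; _∉_)
open import Data.List.Membership.Propositional.Properties using (∈-map⁺; ∈-map⁻; ∈-filter⁻; ∈-++⁻; ∈-applyUpTo⁻)
open import Data.List.Relation.Binary.Permutation.Propositional
  using (_↭_; ↭-refl; ↭-sym; ↭-trans; ↭-prep; ↭⇒↭ₛ)
open import Data.List.Relation.Binary.Permutation.Propositional.Properties
  using (All-resp-↭; ∈-resp-↭; ↭-length; shift) renaming (++⁺ to ++⁺-↭)
open import Data.List.Relation.Binary.Subset.Propositional using (_⊆_)
import Data.List.Relation.Binary.Subset.Propositional.Properties as ⊆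
open import Data.List.Relation.Ternary.Interleaving.Propositional
  using (Interleaving; []; consˡ; consʳ; swap; toPermutation)
open import Data.List.Relation.Ternary.Interleaving.Properties using (interleave-length)
open import Data.List.Relation.Unary.All as All using (All; []; _∷_)
import Data.List.Relation.Unary.All.Properties as AllP
open import Data.List.Relation.Unary.Any using (here; there)
open import Data.List.Relation.Unary.Unique.Propositional using (Unique; []; _∷_)
import Data.List.Relation.Unary.Unique.Propositional.Properties as Unique
open import Data.Maybe as Maybe using (just; nothing)
open import Data.Nat as ℕ using (ℕ; zero; suc; _+_; _<ᵇ_; _<_; _≤_)
import Data.Nat.Properties as ℕP
open import Data.Nat.Tactic.RingSolver using (solve-∀)
open import Data.Product using (_×_; _,_; proj₁; proj₂; ∃-syntax)
open import Data.Sum using (_⊎_; inj₁; inj₂)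
open import Data.Unit using (⊤; tt)
open import Function using (id; _∘_; mk⇔; Equivalence; case_of_)
open import Relation.Binary.Definitions using (tri<; tri≈; tri>)
open import Relation.Binary.PropositionalEquality hiding (preorder)
open import Data.List.Relation.Binary.Permutation.Setoid.Properties (setoid ℕ) using (Unique-resp-↭)
open import Relation.Nullary using (Dec; yes; no; ¬_)
open import Relation.Nullary.Decidable using (⌊_⌋)

toTrue : ∀ {b} → T b → b ≡ true
toTrue = Equivalence.to T-≡

fromTrue : ∀ {b} → b ≡ true → T b
fromTrue = Equivalence.from T-≡

∧-true-left : ∀ {a b} → (a ∧ b) ≡ true → a ≡ true
∧-true-left {true} _ = refl

<ᵇ-true : ∀ {m n} → m < n → (m <ᵇ n) ≡ true
<ᵇ-true m<n = toTrue (ℕP.<⇒<ᵇ m<n)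

<ᵇ-false : ∀ {m n} → ¬ m < n → (m <ᵇ n) ≡ false
<ᵇ-false {m} {n} m≮n with m <ᵇ n in e
... | false = refl
... | true  = ⊥-elim (m≮n (ℕP.<ᵇ⇒< m n (fromTrue e)))

allB-map : ∀ {A B : Set} (h : B → Bool) (k : A → B) xs → allB h (map k xs) ≡ allB (λ p → h (k p)) xs
allB-map h k []       = refl
allB-map h k (x ∷ xs) = cong (h (k x) ∧_) (allB-map h k xs)

allB-cong : ∀ {A : Set} {h₁ h₂ : A → Bool} xs → (∀ {p} → p ∈ xs → h₁ p ≡ h₂ p) → allB h₁ xs ≡ allB h₂ xs
allB-cong []       eq = refl
allB-cong (x ∷ xs) eq = cong₂ _∧_ (eq (here refl)) (allB-cong xs (λ p∈ → eq (there p∈)))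

filter-cong : ∀ {A : Set} {h₁ h₂ : A → Bool} → (∀ a → h₁ a ≡ h₂ a) → ∀ xs →
  filter (λ a → h₁ a ≟B true) xs ≡ filter (λ a → h₂ a ≟B true) xs
filter-cong eq = LP.filter-≐ _ _ ((λ {a} e → trans (sym (eq a)) e) , (λ {a} e → trans (eq a) e))

allB-filter : ∀ {A : Set} (h q : A → Bool) xs → (∀ {p} → p ∈ xs → q p ≡ false → h p ≡ true) →
  allB h (filter (λ p → q p ≟B true) xs) ≡ allB h xs
allB-filter h q []       hyp = refl
allB-filter h q (x ∷ xs) hyp with q x in qx
... | true  = cong (h x ∧_) (allB-filter h q xs (λ p∈ → hyp (there p∈)))
... | false rewrite hyp (here refl) qx = allB-filter h q xs (λ p∈ → hyp (there p∈))

-- Greedy with arbitrary increasing row labels and interval predicate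

Access : Set
Access = ℤ × ℕ

greedyRow : ℕ → (ℕ → ℕ → Bool) → List Point → ℤ → ℕ → List Point
greedyRow n J P i x =
  map (λ a → (a , i)) (filter (λ a → J x a ∧ touched P x i a ≟B true) (range n))

greedy : ℕ → (ℕ → ℕ → Bool) → List Point → List Access → List Point
greedy n J P []             = []
greedy n J P ((i , x) ∷ ys) = greedyRow n J P i x ++ greedy n J (P ++ greedyRow n J P i x) ys

numbered : ℕ → List ℕ → List Access
numbered i []       = []
numbered i (x ∷ xs) = (ℤ.+ i , x) ∷ numbered (suc i) xs

run≡greedy : ∀ n 𝒯 P i X → run n 𝒯 P i X ≡ greedy n (inI 𝒯) P (numbered i X)
run≡greedy n 𝒯 P i []      = refl
run≡greedy n 𝒯 P i (x ∷ X) = cong (rowPts n 𝒯 P i x ++_) (run≡greedy n 𝒯 _ (suc i) X)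

rows : List Point → List ℤ
rows = map proj₂

relabelRows : (ℤ → ℤ) → List Point → List Point
relabelRows f = map (λ p → (proj₁ p , f (proj₂ p)))

OrderEmbeddingOn : (ℤ → ℤ) → List ℤ → Set
OrderEmbeddingOn f R = ∀ {r s} → r ∈ R → s ∈ R → (r ℤ.≤ s → f r ℤ.≤ f s) × (f r ℤ.≤ f s → r ℤ.≤ s)

module _ {f : ℤ → ℤ} {R : List ℤ} (emb : OrderEmbeddingOn f R) {r s : ℤ} (r∈ : r ∈ R) (s∈ : s ∈ R) where

  embedding-injective : f r ≡ f s → r ≡ s
  embedding-injective e = ℤP.≤-antisym (proj₂ (emb r∈ s∈) (ℤP.≤-reflexive e))
                                       (proj₂ (emb s∈ r∈) (ℤP.≤-reflexive (sym e)))

  embedding-≤ᵇ : (f r ℤ.≤ᵇ f s) ≡ (r ℤ.≤ᵇ s)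
  embedding-≤ᵇ = ⇔→≡ (mk⇔ (λ e → toTrue (ℤP.≤⇒≤ᵇ (proj₂ (emb r∈ s∈) (ℤP.≤ᵇ⇒≤ (fromTrue e)))))
                          (λ e → toTrue (ℤP.≤⇒≤ᵇ (proj₁ (emb r∈ s∈) (ℤP.≤ᵇ⇒≤ (fromTrue e))))))

  embedding-≟ : ⌊ f r ℤ.≟ f s ⌋ ≡ ⌊ r ℤ.≟ s ⌋
  embedding-≟ with f r ℤ.≟ f s | r ℤ.≟ s
  ... | yes _  | yes _    = refl
  ... | yes e  | no r≢s   = ⊥-elim (r≢s (embedding-injective e))
  ... | no f≢f | yes refl = ⊥-elim (f≢f refl)
  ... | no _   | no _     = refl

  embedding-⊔ : f (r ℤ.⊔ s) ≡ f r ℤ.⊔ f s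
  embedding-⊔ with ℤP.≤-total r s
  ... | inj₁ r≤s rewrite ℤP.i≤j⇒i⊔j≡j r≤s | ℤP.i≤j⇒i⊔j≡j (proj₁ (emb r∈ s∈) r≤s) = refl
  ... | inj₂ s≤r rewrite ℤP.i≥j⇒i⊔j≡i s≤r | ℤP.i≥j⇒i⊔j≡i (proj₁ (emb s∈ r∈) s≤r) = refl

embedding-⊆ : ∀ {f R R′} → OrderEmbeddingOn f R → R′ ⊆ R → OrderEmbeddingOn f R′
embedding-⊆ emb sub r∈ s∈ = emb (sub r∈) (sub s∈)

maxM-just : ∀ r m {t} → maxM r m ≡ just t → t ≡ r ⊎ m ≡ just t
maxM-just r nothing  refl = inj₁ refl
maxM-just r (just s) refl with ℤP.⊔-sel r s
... | inj₁ r⊔s≡r = inj₁ r⊔s≡r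
... | inj₂ r⊔s≡s = inj₂ (cong just (sym r⊔s≡s))

tau-∈-rows : ∀ P a {t} → tau P a ≡ just t → t ∈ rows P
tau-∈-rows []            a ()
tau-∈-rows ((c , r) ∷ P) a e with c ℕ.≟ a
... | no _ = there (tau-∈-rows P a e)
... | yes _ with maxM-just r (tau P a) e
...   | inj₁ refl = here refl
...   | inj₂ e′   = there (tau-∈-rows P a e′)

tau-relabel : ∀ {f} P a → OrderEmbeddingOn f (rows P) → tau (relabelRows f P) a ≡ Maybe.map f (tau P a)
tau-relabel []            a emb = refl
tau-relabel ((c , r) ∷ P) a emb with c ℕ.≟ a
... | no _  = tau-relabel P a (embedding-⊆ emb there)
... | yes _ rewrite tau-relabel P a (embedding-⊆ emb there) with tau P a in eq
...   | nothing = refl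
...   | just s  = cong just (sym (embedding-⊔ emb (here refl) (there (tau-∈-rows P a eq))))

emptyRectangle : List Point → ℕ → ℤ → ℕ → ℤ → Bool
emptyRectangle P x i a t = allB (λ p → not (inRect a t x i p) ∨ eqPt p (a , t)) P

touched≡emptyRectangle : ∀ P x i a → touched P x i a ≡ Maybe.maybe (emptyRectangle P x i a) false (tau P a)
touched≡emptyRectangle P x i a with tau P a
... | nothing = refl
... | just t  = refl

touched-relabel : ∀ {f} P x i a → OrderEmbeddingOn f (i ∷ rows P) →
  touched (relabelRows f P) x (f i) a ≡ touched P x i a
touched-relabel {f} P x i a emb
  rewrite touched≡emptyRectangle (relabelRows f P) x (f i) a | touched≡emptyRectangle P x i a
        | tau-relabel P a (embedding-⊆ emb there)
  with tau P a in eq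
... | nothing = refl
... | just t  = trans (allB-map _ _ P) (allB-cong P λ p∈ → sameTest (there (∈-map⁺ proj₂ p∈)))
  where
  t∈ : t ∈ i ∷ rows P
  t∈ = there (tau-∈-rows P a eq)
  sameTest : ∀ {c r} → r ∈ i ∷ rows P →
    (not (inRect a (f t) x (f i) (c , f r)) ∨ eqPt (c , f r) (a , f t))
      ≡ (not (inRect a t x i (c , r)) ∨ eqPt (c , r) (a , t))
  sameTest r∈ rewrite embedding-≤ᵇ emb t∈ r∈ | embedding-≤ᵇ emb r∈ (here refl) | embedding-≟ emb r∈ t∈ = refl

greedyRow-relabel : ∀ {f} n J P i x → OrderEmbeddingOn f (i ∷ rows P) →
  greedyRow n J (relabelRows f P) (f i) x ≡ relabelRows f (greedyRow n J P i x)
greedyRow-relabel {f} n J P i x emb =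
  trans (cong (map (λ a → (a , f i)))
              (filter-cong (λ a → cong (J x a ∧_) (touched-relabel P x i a emb)) (range n)))
        (LP.map-∘ (filter (λ a → J x a ∧ touched P x i a ≟B true) (range n)))

-- Locality: an access only sees the columns of its interval

inColumns : (ℕ → Bool) → List Point → List Point
inColumns C = filter (λ p → C (proj₁ p) ≟B true)

Disjoint : (ℕ → Bool) → (ℕ → Bool) → Set
Disjoint C D = ∀ c → C c ≡ true → D c ≡ true → ⊥

record Confined (J : ℕ → ℕ → Bool) (C : ℕ → Bool) (y : ℕ) : Set where
  field
    interval⊆ : ∀ a → J y a ≡ true → C a ≡ true
    between⊆  : ∀ a → C a ≡ true → ∀ c → a ℕ.⊓ y ≤ c → c ≤ a ℕ.⊔ y → C c ≡ true

tau-inColumns : ∀ C P a → C a ≡ true → tau (inColumns C P) a ≡ tau P a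
tau-inColumns C []            a Ca = refl
tau-inColumns C ((c , r) ∷ P) a Ca with C c in Cc
... | true rewrite tau-inColumns C P a Ca = refl
... | false with c ℕ.≟ a
...   | yes refl = case trans (sym Cc) Ca of λ ()
...   | no _     = tau-inColumns C P a Ca

touched-inColumns : ∀ C P y i a → C a ≡ true → (∀ c → a ℕ.⊓ y ≤ c → c ≤ a ℕ.⊔ y → C c ≡ true) →
  touched (inColumns C P) y i a ≡ touched P y i a
touched-inColumns C P y i a Ca between
  rewrite touched≡emptyRectangle (inColumns C P) y i a | touched≡emptyRectangle P y i a | tau-inColumns C P a Ca
  with tau P a
... | nothing = refl
... | just t  = allB-filter _ (λ p → C (proj₁ p)) P outside
  where
  outside : ∀ {p} → p ∈ P → C (proj₁ p) ≡ false → (not (inRect a t y i p) ∨ eqPt p (a , t)) ≡ true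
  outside {c , r} _ Cc with (a ℕ.⊓ y) ℕ.≤ᵇ c in lo≤c | c ℕ.≤ᵇ (a ℕ.⊔ y) in c≤hi
  ... | false | _     = refl
  ... | true  | false = refl
  ... | true  | true  =
    case trans (sym Cc) (between c (ℕP.≤ᵇ⇒≤ _ _ (fromTrue lo≤c)) (ℕP.≤ᵇ⇒≤ _ _ (fromTrue c≤hi))) of λ ()

module _ (n : ℕ) (J : ℕ → ℕ → Bool) where

  greedyRow-⊆-interval : ∀ P i y {p} → p ∈ greedyRow n J P i y → J y (proj₁ p) ≡ true
  greedyRow-⊆-interval P i y p∈ with ∈-map⁻ _ p∈
  ... | a , a∈ , refl = ∧-true-left (proj₂ (∈-filter⁻ (λ a → J y a ∧ touched P y i a ≟B true) {xs = range n} a∈))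

  module _ {C : ℕ → Bool} {y : ℕ} (conf : Confined J C y) (P : List Point) (i : ℤ) where
    open Confined conf

    private
      new : List Point
      new = greedyRow n J P i y

    greedyRow-inColumns : greedyRow n J (inColumns C P) i y ≡ greedyRow n J P i y
    greedyRow-inColumns = cong (map _) (filter-cong sameTest (range n))
      where
      sameTest : ∀ a → (J y a ∧ touched (inColumns C P) y i a) ≡ (J y a ∧ touched P y i a)
      sameTest a with J y a in Jya
      ... | false = refl
      ... | true  = touched-inColumns C P y i a (interval⊆ a Jya) (between⊆ a (interval⊆ a Jya))

    inColumns-after-inside : inColumns C (P ++ new) ≡ inColumns C P ++ new
    inColumns-after-inside =
      trans (LP.filter-++ _ P _)
            (cong (inColumns C P ++_) (LP.filter-all _ (All.tabulate λ p∈ → interval⊆ _ (greedyRow-⊆-interval P i y p∈))))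

    inColumns-after-outside : ∀ {D} → Disjoint D C → inColumns D (P ++ new) ≡ inColumns D P
    inColumns-after-outside disj =
      trans (LP.filter-++ _ P _)
            (trans (cong (inColumns _ P ++_)
                         (LP.filter-none _ (All.tabulate λ p∈ Dp → disj _ Dp (interval⊆ _ (greedyRow-⊆-interval P i y p∈)))))
                   (LP.++-identityʳ _))

    greedy-length-step : ∀ {D W L R} → Disjoint D C →
      length (greedy n J (P ++ new) W)
        ≡ length (greedy n J (inColumns C (P ++ new)) L) + length (greedy n J (inColumns D (P ++ new)) R) →
      length (greedy n J P ((i , y) ∷ W))
        ≡ length (greedy n J (inColumns C P) ((i , y) ∷ L)) + length (greedy n J (inColumns D P) R)
    greedy-length-step {D} {W} {L} {R} disj split = begin
      length (new ++ greedy n J (P ++ new) W)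
        ≡⟨ LP.length-++ new ⟩
      length new + length (greedy n J (P ++ new) W)
        ≡⟨ cong (length new +_) split ⟩
      length new + (length (greedy n J (inColumns C (P ++ new)) L) + costD (P ++ new))
        ≡⟨ sym (ℕP.+-assoc (length new) _ _) ⟩
      (length new + length (greedy n J (inColumns C (P ++ new)) L)) + costD (P ++ new)
        ≡⟨ cong₂ _+_ (sym (LP.length-++ new)) (cong (λ Q → length (greedy n J Q R)) (inColumns-after-outside disj)) ⟩
      length (new ++ greedy n J (inColumns C (P ++ new)) L) + costD P
        ≡⟨ cong (λ Q → length (new ++ greedy n J Q L) + costD P) inColumns-after-inside ⟩
      length (new ++ greedy n J (inColumns C P ++ new) L) + costD P
        ≡⟨ cong (λ new′ → length (new′ ++ greedy n J (inColumns C P ++ new′) L) + costD P) (sym greedyRow-inColumns) ⟩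
      length (greedy n J (inColumns C P) ((i , y) ∷ L)) + costD P ∎
      where
      open ≡-Reasoning
      costD : List Point → ℕ
      costD Q = length (greedy n J (inColumns D Q) R)

  greedy-length-split : ∀ {CL CR W L R} → Interleaving L R W →
    All (Confined J CL ∘ proj₂) L → All (Confined J CR ∘ proj₂) R → Disjoint CL CR → ∀ P →
    length (greedy n J P W) ≡ length (greedy n J (inColumns CL P) L) + length (greedy n J (inColumns CR P) R)
  greedy-length-split []         []             []             disj P = refl
  greedy-length-split {CL} {CR} {(i , _) ∷ W} {_ ∷ L} {R} (consˡ il) (conf ∷ confL) confR disj P =
    greedy-length-step conf P i {CR} {W} {L} {R} (λ c CRc CLc → disj c CLc CRc) (greedy-length-split il confL confR disj _)
  greedy-length-split {CL} {CR} {(i , y) ∷ W} {L} {_ ∷ R} (consʳ il) confL (conf ∷ confR) disj P =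
    trans (greedy-length-step conf P i {CL} {W} {R} {L} disj
             (trans (greedy-length-split il confL confR disj (P ++ new)) (ℕP.+-comm (costL (P ++ new)) (costR (P ++ new)))))
          (ℕP.+-comm (length (greedy n J (inColumns CR P) ((i , y) ∷ R))) (costL P))
    where
    new : List Point
    new = greedyRow n J P i y
    costL costR : List Point → ℕ
    costL Q = length (greedy n J (inColumns CL Q) L)
    costR Q = length (greedy n J (inColumns CR Q) R)

Between : ℕ → ℕ → ℕ → Set
Between lo hi a = lo < a × a < hi

between? : ℕ → ℕ → ℕ → Bool
between? lo hi c = (lo <ᵇ c) ∧ (c <ᵇ hi)

between?-complete : ∀ {lo hi c} → Between lo hi c → between? lo hi c ≡ true
between?-complete (lo<c , c<hi) rewrite <ᵇ-true lo<c | <ᵇ-true c<hi = refl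

between?-sound : ∀ lo hi c → between? lo hi c ≡ true → Between lo hi c
between?-sound lo hi c e with lo <ᵇ c in lo<c | c <ᵇ hi in c<hi
... | true | true = ℕP.<ᵇ⇒< _ _ (fromTrue lo<c) , ℕP.<ᵇ⇒< _ _ (fromTrue c<hi)

between?-disjoint : ∀ lo x hi → Disjoint (between? lo x) (between? x hi)
between?-disjoint lo x hi c left right =
  ℕP.<-asym (proj₂ (between?-sound lo x c left)) (proj₁ (between?-sound x hi c right))

between-weaken : ∀ {lo hi lo′ hi′ a} → lo′ ≤ lo → hi ≤ hi′ → Between lo hi a → Between lo′ hi′ a
between-weaken lo′≤lo hi≤hi′ (lo<a , a<hi) = ℕP.≤-<-trans lo′≤lo lo<a , ℕP.<-≤-trans a<hi hi≤hi′

-- The access sequences X with 𝒯_X = B whose keys lie strictly between lo and hi.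
data InsertionOrder {A : Set} (key : A → ℕ) : ℕ → ℕ → Tree → List A → Set where
  leaf : ∀ {lo hi} → InsertionOrder key lo hi leaf []
  node : ∀ {lo hi l x r q W Wl Wr} → key q ≡ x → Between lo hi x → Interleaving Wl Wr W →
         InsertionOrder key lo x l Wl → InsertionOrder key x hi r Wr →
         InsertionOrder key lo hi (node l x r) (q ∷ W)

AccessOrder : ℕ → ℕ → Tree → List Access → Set
AccessOrder = InsertionOrder proj₂

All-interleave : ∀ {A : Set} {Q : A → Set} {W L R} → Interleaving L R W → All Q L → All Q R → All Q W
All-interleave il QL QR = All-resp-↭ (↭-sym (toPermutation il)) (AllP.++⁺ QL QR)

insertionOrder-within : ∀ {A : Set} {key : A → ℕ} {lo hi B W} → InsertionOrder key lo hi B W →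
  All (Between lo hi ∘ key) W
insertionOrder-within leaf = []
insertionOrder-within (node refl lo<x<hi il ol or) =
  lo<x<hi ∷ All-interleave il (All.map (between-weaken ℕP.≤-refl (ℕP.<⇒≤ (proj₂ lo<x<hi))) (insertionOrder-within ol))
                              (All.map (between-weaken (ℕP.<⇒≤ (proj₁ lo<x<hi)) ℕP.≤-refl) (insertionOrder-within or))

IntervalsWithin : (ℕ → ℕ → Bool) → ℕ → ℕ → Tree → Set
IntervalsWithin J lo hi leaf         = ⊤
IntervalsWithin J lo hi (node l x r) =
  (∀ a → J x a ≡ true → Between lo hi a) × IntervalsWithin J lo x l × IntervalsWithin J x hi r

AccessWithin : (ℕ → ℕ → Bool) → ℕ → ℕ → ℕ → Set
AccessWithin J lo hi y = Between lo hi y × (∀ a → J y a ≡ true → Between lo hi a)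

accessWithin-weaken : ∀ J {lo hi lo′ hi′ y} → lo′ ≤ lo → hi ≤ hi′ →
  AccessWithin J lo hi y → AccessWithin J lo′ hi′ y
accessWithin-weaken J lo′≤lo hi≤hi′ (y-within , interval-within) =
  between-weaken lo′≤lo hi≤hi′ y-within , λ a Jya → between-weaken lo′≤lo hi≤hi′ (interval-within a Jya)

accessesWithin : ∀ J {A : Set} {key : A → ℕ} {lo hi B W} → InsertionOrder key lo hi B W → IntervalsWithin J lo hi B →
  All (AccessWithin J lo hi ∘ key) W
accessesWithin J leaf _ = []
accessesWithin J (node refl lo<x<hi il ol or) (root , within-l , within-r) =
  (lo<x<hi , root) ∷
  All-interleave il (All.map (accessWithin-weaken J ℕP.≤-refl (ℕP.<⇒≤ (proj₂ lo<x<hi))) (accessesWithin J ol within-l))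
                    (All.map (accessWithin-weaken J (ℕP.<⇒≤ (proj₁ lo<x<hi)) ℕP.≤-refl) (accessesWithin J or within-r))

confined-between : ∀ J {lo hi y} → AccessWithin J lo hi y → Confined J (between? lo hi) y
confined-between J {lo} {hi} {y} ((lo<y , y<hi) , interval-within) = record
  { interval⊆ = λ a Jya → between?-complete (interval-within a Jya)
  ; between⊆  = λ a a-between c a⊓y≤c c≤a⊔y →
      let (lo<a , a<hi) = between?-sound lo hi a a-between
      in between?-complete (ℕP.<-≤-trans (ℕP.⊓-pres-m< lo<a lo<y) a⊓y≤c ,
                            ℕP.≤-<-trans c≤a⊔y (ℕP.⊔-pres-<m a<hi y<hi))
  }

-- Runs kept in step by a row relabelling

RowsIncreasingFrom : ℤ → List Access → Set
RowsIncreasingFrom b []             = ⊤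
RowsIncreasingFrom b ((i , _) ∷ ys) = b ℤ.< i × RowsIncreasingFrom i ys

rowsIncreasing-weaken : ∀ {b c} ys → b ℤ.≤ c → RowsIncreasingFrom c ys → RowsIncreasingFrom b ys
rowsIncreasing-weaken []       b≤c _            = tt
rowsIncreasing-weaken (_ ∷ ys) b≤c (c<i , incr) = ℤP.≤-<-trans b≤c c<i , incr

rowsIncreasing-left : ∀ {b W L R} → Interleaving L R W → RowsIncreasingFrom b W → RowsIncreasingFrom b L
rowsIncreasing-left []                           _            = tt
rowsIncreasing-left (consˡ il)                   (b<i , incr) = b<i , rowsIncreasing-left il incr
rowsIncreasing-left {L = L} (consʳ il)           (b<i , incr) =
  rowsIncreasing-weaken L (ℤP.<⇒≤ b<i) (rowsIncreasing-left il incr)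

RowsAtMost : ℤ → List Point → Set
RowsAtMost b = All (λ p → proj₂ p ℤ.≤ b)

record Synchronised (f : ℤ → ℤ) (b b′ : ℤ) (P : List Point) : Set where
  field
    rowsAtMost  : RowsAtMost b P
    rowsAtMost′ : RowsAtMost b′ (relabelRows f P)
    embedding   : OrderEmbeddingOn f (rows P)

relabel-inColumns : ∀ C g P → inColumns C (relabelRows g P) ≡ relabelRows g (inColumns C P)
relabel-inColumns C g []      = refl
relabel-inColumns C g (p ∷ P) with C (proj₁ p)
... | true  = cong (_ ∷_) (relabel-inColumns C g P)
... | false = relabel-inColumns C g P

synchronised-inColumns : ∀ {f b b′} C {P} → Synchronised f b b′ P → Synchronised f b b′ (inColumns C P)
synchronised-inColumns {f} C {P} sync = record
  { rowsAtMost  = AllP.filter⁺ inC? rowsAtMost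
  ; rowsAtMost′ = subst (RowsAtMost _) (relabel-inColumns C f P) (AllP.filter⁺ inC? rowsAtMost′)
  ; embedding   = embedding-⊆ embedding (⊆.map⁺ proj₂ (⊆.filter-⊆ inC? P))
  }
  where
  open Synchronised sync
  inC? : (p : Point) → Dec (C (proj₁ p) ≡ true)
  inC? p = C (proj₁ p) ≟B true

extend : (ℤ → ℤ) → ℤ → ℤ → ℤ → ℤ
extend f i i′ r = if ⌊ r ℤ.≟ i ⌋ then i′ else f r

extend-new : ∀ f i i′ → extend f i i′ i ≡ i′
extend-new f i i′ with i ℤ.≟ i
... | yes _   = refl
... | no i≢i = ⊥-elim (i≢i refl)

extend-old : ∀ f i i′ r → r ℤ.< i → extend f i i′ r ≡ f r
extend-old f i i′ r r<i with r ℤ.≟ i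
... | yes refl = ⊥-elim (ℤP.<-irrefl refl r<i)
... | no _     = refl

module _ {f : ℤ → ℤ} {b b′ i i′ : ℤ} {P : List Point} (sync : Synchronised f b b′ P)
         (b<i : b ℤ.< i) (b′<i′ : b′ ℤ.< i′) where
  open Synchronised sync

  private
    g : ℤ → ℤ
    g = extend f i i′

    old<i : ∀ {r} → r ∈ rows P → r ℤ.< i
    old<i r∈ with ∈-map⁻ proj₂ r∈
    ... | _ , p∈ , refl = ℤP.≤-<-trans (All.lookup rowsAtMost p∈) b<i

    g-old<i′ : ∀ {r} → r ∈ rows P → g r ℤ.< i′
    g-old<i′ {r} r∈ with ∈-map⁻ proj₂ r∈
    ... | _ , p∈ , refl rewrite extend-old f i i′ r (old<i r∈) =
      ℤP.≤-<-trans (All.lookup (AllP.map⁻ {xs = P} rowsAtMost′) p∈) b′<i′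

  relabel-extend-old : relabelRows g P ≡ relabelRows f P
  relabel-extend-old = LP.map-cong-local (All.tabulate λ p∈ →
    cong (_ ,_) (extend-old f i i′ _ (old<i (∈-map⁺ proj₂ p∈))))

  module _ {new : List Point} (newRow : All (λ p → proj₂ p ≡ i) new) where

    private
      oldOrNew : ∀ {r} → r ∈ i ∷ rows (P ++ new) → r ≡ i ⊎ r ∈ rows P
      oldOrNew (here r≡i) = inj₁ r≡i
      oldOrNew (there r∈) with ∈-map⁻ proj₂ r∈
      ... | p , p∈ , refl with ∈-++⁻ P p∈
      ...   | inj₁ p∈P   = inj₂ (∈-map⁺ proj₂ p∈P)
      ...   | inj₂ p∈new = inj₁ (All.lookup newRow p∈new)

    extend-embedding : OrderEmbeddingOn g (i ∷ rows (P ++ new))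
    extend-embedding r∈ s∈ with oldOrNew r∈ | oldOrNew s∈
    ... | inj₁ refl | inj₁ refl = (λ _ → ℤP.≤-refl) , (λ _ → ℤP.≤-refl)
    ... | inj₁ refl | inj₂ sP   =
      (λ i≤s → ⊥-elim (ℤP.<⇒≱ (old<i sP) i≤s)) ,
      (λ gi≤gs → ⊥-elim (ℤP.<⇒≱ (g-old<i′ sP) (subst (ℤ._≤ g _) (extend-new f i i′) gi≤gs)))
    ... | inj₂ rP   | inj₁ refl =
      (λ _ → subst (g _ ℤ.≤_) (sym (extend-new f i i′)) (ℤP.<⇒≤ (g-old<i′ rP))) , (λ _ → ℤP.<⇒≤ (old<i rP))
    ... | inj₂ rP   | inj₂ sP
      rewrite extend-old f i i′ _ (old<i rP) | extend-old f i i′ _ (old<i sP) = embedding rP sP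

    synchronised-step : Synchronised g i i′ (P ++ new)
    synchronised-step = record
      { rowsAtMost  = AllP.++⁺ (All.map (λ r≤b → ℤP.≤-trans r≤b (ℤP.<⇒≤ b<i)) rowsAtMost)
                               (All.map ℤP.≤-reflexive newRow)
      ; rowsAtMost′ = subst (RowsAtMost i′) (sym (LP.map-++ _ P new))
          (AllP.++⁺ (subst (RowsAtMost i′) (sym relabel-extend-old)
                           (All.map (λ r≤b′ → ℤP.≤-trans r≤b′ (ℤP.<⇒≤ b′<i′)) rowsAtMost′))
                    (AllP.map⁺ (All.map (λ r≡i → ℤP.≤-reflexive (trans (cong g r≡i) (extend-new f i i′))) newRow)))
      ; embedding   = embedding-⊆ extend-embedding there
      }

module _ (n : ℕ) (J : ℕ → ℕ → Bool) where

  accessOrder-confined : ∀ {lo hi B W} → AccessOrder lo hi B W → IntervalsWithin J lo hi B →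
    All (Confined J (between? lo hi) ∘ proj₂) W
  accessOrder-confined order within = All.map (confined-between J) (accessesWithin J order within)

  greedy-length-insertionOrder-invariant : ∀ {lo hi B W W′} → IntervalsWithin J lo hi B →
    AccessOrder lo hi B W → AccessOrder lo hi B W′ →
    ∀ {f b b′ P} → RowsIncreasingFrom b W → RowsIncreasingFrom b′ W′ → Synchronised f b b′ P →
    length (greedy n J P W) ≡ length (greedy n J (relabelRows f P) W′)
  greedy-length-insertionOrder-invariant _ leaf leaf _ _ _ = refl
  greedy-length-insertionOrder-invariant {lo} {hi} (_ , within-l , within-r)
      (node {l = l} {x} {r} {q = i , _} {W} {Wl} {Wr} refl _ il ol or)
      (node {q = i′ , _} {W′} {Wl′} {Wr′} refl _ il′ ol′ or′)
      {f} {P = P} (b<i , incr) (b′<i′ , incr′) sync = begin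
    length (new ++ greedy n J P₁ W)
      ≡⟨ LP.length-++ new ⟩
    length new + length (greedy n J P₁ W)
      ≡⟨ cong (length new +_) (split il ol or P₁) ⟩
    length new + (length (greedy n J (inColumns CL P₁) Wl) + length (greedy n J (inColumns CR P₁) Wr))
      ≡⟨ cong₂ _+_ (sym (LP.length-map _ new)) (cong₂ _+_ (invariant-below CL within-l ol ol′ il il′)
                                                            (invariant-below CR within-r or or′ (swap il) (swap il′))) ⟩
    length (relabelRows g new) + (length (greedy n J (inColumns CL Q₁) Wl′) + length (greedy n J (inColumns CR Q₁) Wr′))
      ≡⟨ cong (length (relabelRows g new) +_) (sym (split il′ ol′ or′ Q₁)) ⟩
    length (relabelRows g new) + length (greedy n J Q₁ W′)
      ≡⟨ sym (LP.length-++ (relabelRows g new)) ⟩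
    length (relabelRows g new ++ greedy n J Q₁ W′)
      ≡⟨ cong₂ (λ new′ Q → length (new′ ++ greedy n J Q W′)) (sym new′≡) Q₁≡ ⟩
    length (new′ ++ greedy n J (relabelRows f P ++ new′) W′) ∎
    where
    open ≡-Reasoning
    g : ℤ → ℤ
    g = extend f i i′
    new new′ P₁ Q₁ : List Point
    new  = greedyRow n J P i x
    new′ = greedyRow n J (relabelRows f P) i′ x
    P₁   = P ++ new
    Q₁   = relabelRows g P₁
    CL CR : ℕ → Bool
    CL = between? lo x
    CR = between? x hi
    newRow : All (λ p → proj₂ p ≡ i) new
    newRow = AllP.map⁺ (All.universal (λ _ → refl) _)
    split : ∀ {V Vl Vr} → Interleaving Vl Vr V → AccessOrder lo x l Vl → AccessOrder x hi r Vr → ∀ Q →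
      length (greedy n J Q V) ≡ length (greedy n J (inColumns CL Q) Vl) + length (greedy n J (inColumns CR Q) Vr)
    split il ol or = greedy-length-split n J il (accessOrder-confined ol within-l) (accessOrder-confined or within-r)
                                         (between?-disjoint lo x hi)
    new′≡ : new′ ≡ relabelRows g new
    new′≡ = trans (cong₂ (λ Q k → greedyRow n J Q k x) (sym (relabel-extend-old sync b<i b′<i′)) (sym (extend-new f i i′)))
                  (greedyRow-relabel n J P i x (embedding-⊆ (extend-embedding sync b<i b′<i′ newRow)
                                                            (⊆.∷⁺ʳ i (⊆.map⁺ proj₂ (⊆.xs⊆xs++ys P new)))))
    Q₁≡ : Q₁ ≡ relabelRows f P ++ new′
    Q₁≡ = trans (LP.map-++ _ P new) (cong₂ _++_ (relabel-extend-old sync b<i b′<i′) (sym new′≡))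
    invariant-below : ∀ C {lo′ hi′ t Vl Vl′ Vr Vr′} → IntervalsWithin J lo′ hi′ t →
      AccessOrder lo′ hi′ t Vl → AccessOrder lo′ hi′ t Vl′ →
      Interleaving Vl Vr W → Interleaving Vl′ Vr′ W′ →
      length (greedy n J (inColumns C P₁) Vl) ≡ length (greedy n J (inColumns C Q₁) Vl′)
    invariant-below C {Vl′ = Vl′} within o o′ ilv ilv′ =
      trans (greedy-length-insertionOrder-invariant within o o′
               (rowsIncreasing-left ilv incr) (rowsIncreasing-left ilv′ incr′)
               (synchronised-inColumns C (synchronised-step sync b<i b′<i′ newRow)))
            (cong (λ Q → length (greedy n J Q Vl′)) (sym (relabel-inColumns C g P₁)))

KeyOrder : ℕ → ℕ → Tree → List ℕ → Set
KeyOrder = InsertionOrder id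

interleave-around : ∀ x W → x ∉ W → Interleaving (filter (ℕP._<? x) W) (filter (x ℕP.<?_) W) W
interleave-around x []      _   = []
interleave-around x (y ∷ W) x∉ with ℕP.<-cmp y x
... | tri< y<x _ x≮y rewrite <ᵇ-true y<x | <ᵇ-false x≮y =
  consˡ (interleave-around x W (x∉ ∘ there))
... | tri≈ _ y≡x _ = ⊥-elim (x∉ (here (sym y≡x)))
... | tri> y≮x _ x<y rewrite <ᵇ-false y≮x | <ᵇ-true x<y =
  consʳ (interleave-around x W (x∉ ∘ there))

keyOrder-exists : ∀ k {lo hi} xs → length xs ≤ k → Unique xs → All (Between lo hi) xs → ∃[ B ] KeyOrder lo hi B xs
keyOrder-exists k       []      _            _              _                    = leaf , leaf
keyOrder-exists (suc k) {lo} {hi} (x ∷ W) (ℕ.s≤s |W|≤k) (x∉W ∷ uniqueW) (lo<x<hi ∷ W-between) =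
  node (proj₁ left) x (proj₁ right) ,
  node refl lo<x<hi (interleave-around x W (AllP.All¬⇒¬Any x∉W)) (proj₂ left) (proj₂ right)
  where
  part : ∀ {P : ℕ → Set} (P? : ∀ c → Dec (P c)) {lo′ hi′} →
    (∀ {c} → Between _ _ c → P c → Between lo′ hi′ c) → ∃[ B ] KeyOrder lo′ hi′ B (filter P? W)
  part P? within = keyOrder-exists k (filter P? W) (ℕP.≤-trans (LP.length-filter P? W) |W|≤k) (Unique.filter⁺ P? uniqueW)
    (All.tabulate λ c∈ → let (c∈W , Pc) = ∈-filter⁻ P? {xs = W} c∈ in within (All.lookup W-between c∈W) Pc)
  left  : ∃[ B ] KeyOrder lo x B (filter (ℕP._<? x) W)
  left  = part (ℕP._<? x) λ (lo<c , _) c<x → lo<c , c<x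
  right : ∃[ B ] KeyOrder x hi B (filter (x ℕP.<?_) W)
  right = part (x ℕP.<?_) λ (_ , c<hi) x<c → x<c , c<hi

insert-left : ∀ {y x} l r → y < x → insert y (node l x r) ≡ node (insert y l) x r
insert-left l r y<x rewrite <ᵇ-true y<x = refl

insert-right : ∀ {y x} l r → x < y → insert y (node l x r) ≡ node l x (insert y r)
insert-right l r x<y rewrite <ᵇ-false (ℕP.<⇒≯ x<y) | <ᵇ-true x<y = refl

insertAll : Tree → List ℕ → Tree
insertAll = foldl (λ t z → insert z t)

insertAll-interleave : ∀ {W L R} l x r → Interleaving L R W → All (_< x) L → All (x <_) R →
  insertAll (node l x r) W ≡ node (insertAll l L) x (insertAll r R)
insertAll-interleave l x r [] _ _ = refl
insertAll-interleave {y ∷ _} l x r (consˡ il) (y<x ∷ L<x) R>x rewrite insert-left l r y<x =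
  insertAll-interleave (insert y l) x r il L<x R>x
insertAll-interleave {y ∷ _} l x r (consʳ il) L<x (x<y ∷ R>x) rewrite insert-right l r x<y =
  insertAll-interleave l x (insert y r) il L<x R>x

buildBST-keyOrder : ∀ {lo hi B ks} → KeyOrder lo hi B ks → buildBST ks ≡ B
buildBST-keyOrder leaf = refl
buildBST-keyOrder (node {x = x} refl _ il ol or) =
  trans (insertAll-interleave leaf x leaf il (All.map proj₂ (insertionOrder-within ol)) (All.map proj₁ (insertionOrder-within or)))
        (cong₂ (λ l r → node l x r) (buildBST-keyOrder ol) (buildBST-keyOrder or))

keyOrder-↭-keys : ∀ {lo hi B ks} → KeyOrder lo hi B ks → ks ↭ keys B
keyOrder-↭-keys leaf = ↭-refl
keyOrder-↭-keys (node {l = l} {x} {r} refl _ il ol or) =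
  ↭-trans (↭-prep x (↭-trans (toPermutation il) (++⁺-↭ (keyOrder-↭-keys ol) (keyOrder-↭-keys or))))
          (↭-sym (shift x (keys l) (keys r)))

preorderKeys : Tree → List ℕ
preorderKeys leaf         = []
preorderKeys (node l x r) = x ∷ (preorderKeys l ++ preorderKeys r)

interleave-++ : ∀ {A : Set} (xs ys : List A) → Interleaving xs ys (xs ++ ys)
interleave-++ []       []       = []
interleave-++ []       (y ∷ ys) = consʳ (interleave-++ [] ys)
interleave-++ (x ∷ xs) ys       = consˡ (interleave-++ xs ys)

keyOrder-preorder : ∀ {lo hi B ks} → KeyOrder lo hi B ks → KeyOrder lo hi B (preorderKeys B)
keyOrder-preorder leaf = leaf
keyOrder-preorder (node {l = l} {r = r} refl lo<x<hi _ ol or) =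
  node refl lo<x<hi (interleave-++ (preorderKeys l) (preorderKeys r)) (keyOrder-preorder ol) (keyOrder-preorder or)

interleave-unmap : ∀ {A B : Set} (f : A → B) {L R} (W : List A) → Interleaving L R (map f W) →
  ∃[ Wl ] ∃[ Wr ] (Interleaving Wl Wr W × map f Wl ≡ L × map f Wr ≡ R)
interleave-unmap f []      []         = [] , [] , [] , refl , refl
interleave-unmap f (w ∷ W) (consˡ il) with interleave-unmap f W il
... | Wl , Wr , il′ , refl , refl = w ∷ Wl , Wr , consˡ il′ , refl , refl
interleave-unmap f (w ∷ W) (consʳ il) with interleave-unmap f W il
... | Wl , Wr , il′ , refl , refl = Wl , w ∷ Wr , consʳ il′ , refl , refl

insertionOrder-unmap : ∀ {A : Set} {key : A → ℕ} {lo hi B} (W : List A) → KeyOrder lo hi B (map key W) →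
  InsertionOrder key lo hi B W
insertionOrder-unmap []      leaf = leaf
insertionOrder-unmap (w ∷ W) (node refl lo<x<hi il ol or) with interleave-unmap _ W il
... | Wl , Wr , il′ , refl , refl = node refl lo<x<hi il′ (insertionOrder-unmap Wl ol) (insertionOrder-unmap Wr or)

keys-within : ∀ {lo hi B ks} → KeyOrder lo hi B ks → All (Between lo hi) (keys B)
keys-within order = All-resp-↭ (keyOrder-↭-keys order) (insertionOrder-within order)

subtreeAt-root : ∀ l x r → subtreeAt x (node l x r) ≡ just (node l x r)
subtreeAt-root l x r rewrite <ᵇ-false (ℕP.<-irrefl {x} refl) = refl

inI-left : ∀ {y x} l r a → y < x → inI (node l x r) y a ≡ inI l y a
inI-left l r a y<x rewrite <ᵇ-true y<x = refl

inI-right : ∀ {y x} l r a → x < y → inI (node l x r) y a ≡ inI r y a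
inI-right l r a x<y rewrite <ᵇ-false (ℕP.<⇒≯ x<y) | <ᵇ-true x<y = refl

inI-root-within : ∀ {lo hi l x r ks} → KeyOrder lo hi (node l x r) ks →
  ∀ a → inI (node l x r) x a ≡ true → Between lo hi a
inI-root-within {lo} {hi} {l} {x} {r} order@(node _ (lo<x , x<hi) _ _ _) a inI≡true
  rewrite subtreeAt-root l x r with (lo≤a , a≤hi) ← T-∧ .Equivalence.to (fromTrue inI≡true) =
  ℕP.<-≤-trans (LP.foldr-preservesᵇ ℕP.⊓-pres-m< lo<x (All.map proj₁ (keys-within order))) (ℕP.≤ᵇ⇒≤ _ _ lo≤a) ,
  ℕP.≤-<-trans (ℕP.≤ᵇ⇒≤ _ _ a≤hi) (LP.foldr-preservesᵇ ℕP.⊔-pres-<m x<hi (All.map proj₂ (keys-within order)))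

intervalsWithin-cong : ∀ {J J′ lo hi B ks} → KeyOrder lo hi B ks → IntervalsWithin J lo hi B →
  (∀ y → Between lo hi y → ∀ a → J′ y a ≡ J y a) → IntervalsWithin J′ lo hi B
intervalsWithin-cong leaf _ _ = tt
intervalsWithin-cong (node {x = x} refl lo<x<hi _ ol or) (root , within-l , within-r) J′≡J =
  (λ a J′xa → root a (trans (sym (J′≡J x lo<x<hi a)) J′xa)) ,
  intervalsWithin-cong ol within-l (λ y (lo<y , y<x) → J′≡J y (lo<y , ℕP.<-trans y<x (proj₂ lo<x<hi))) ,
  intervalsWithin-cong or within-r (λ y (x<y , y<hi) → J′≡J y (ℕP.<-trans (proj₁ lo<x<hi) x<y , y<hi))

intervalsWithin-inI : ∀ {lo hi B ks} → KeyOrder lo hi B ks → IntervalsWithin (inI B) lo hi B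
intervalsWithin-inI leaf = tt
intervalsWithin-inI order@(node {l = l} {x} {r} refl _ _ ol or) =
  inI-root-within order ,
  intervalsWithin-cong ol (intervalsWithin-inI ol) (λ y (_ , y<x) a → inI-left l r a y<x) ,
  intervalsWithin-cong or (intervalsWithin-inI or) (λ y (x<y , _) a → inI-right l r a x<y)

-- Shapes: a search tree on exactly the keys lo+1, …, hi-1 is determined by its shape

shape : Tree → BT
shape leaf         = lf
shape (node l _ r) = nd (shape l) (shape r)

inorderLabelled : ℕ → BT → Tree
inorderLabelled o lf       = leaf
inorderLabelled o (nd l r) = node (inorderLabelled o l) (o + size l + 1) (inorderLabelled (o + size l + 1) r)

preorderKeys-inorderLabelled : ∀ o S → preorderKeys (inorderLabelled o S) ≡ preorder o S
preorderKeys-inorderLabelled o lf       = refl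
preorderKeys-inorderLabelled o (nd l r) =
  cong (_ ∷_) (cong₂ _++_ (preorderKeys-inorderLabelled o l) (preorderKeys-inorderLabelled (o + size l + 1) r))

private
  suc[m+n]≡m+1+n : ∀ m n → suc (m + n) ≡ m + 1 + n
  suc[m+n]≡m+1+n = solve-∀

  m+0+1≡1+m : ∀ m → m + 0 + 1 ≡ suc m
  m+0+1≡1+m = solve-∀

  m+[n+1+o]+1≡m+n+1+o+1 : ∀ m n o → m + (n + 1 + o) + 1 ≡ m + n + 1 + o + 1
  m+[n+1+o]+1≡m+n+1+o+1 = solve-∀

module _ {A : Set} {key : A → ℕ} where

  length-insertionOrder : ∀ {lo hi B W} → InsertionOrder key lo hi B W → length W ≡ size (shape B)
  length-insertionOrder leaf = refl
  length-insertionOrder (node {l = l} {r = r} {W = W} {Wl} {Wr} refl _ il ol or) = begin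
    suc (length W)                           ≡⟨ cong suc (interleave-length il) ⟩
    suc (length Wl + length Wr)              ≡⟨ cong suc (cong₂ _+_ (length-insertionOrder ol) (length-insertionOrder or)) ⟩
    suc (size (shape l) + size (shape r))    ≡⟨ suc[m+n]≡m+1+n (size (shape l)) (size (shape r)) ⟩
    size (shape l) + 1 + size (shape r)      ∎
    where open ≡-Reasoning

  insertionOrder-size-bound : ∀ {lo hi B W} → InsertionOrder key lo hi B W → lo < hi → lo + size (shape B) + 1 ≤ hi
  insertionOrder-size-bound {lo} {hi} leaf lo<hi = subst (_≤ hi) (sym (m+0+1≡1+m lo)) lo<hi
  insertionOrder-size-bound {lo} {hi} (node {l = l} {x} {r} refl (lo<x , x<hi) _ ol or) _ = begin
    lo + (size (shape l) + 1 + size (shape r)) + 1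
      ≡⟨ m+[n+1+o]+1≡m+n+1+o+1 lo (size (shape l)) (size (shape r)) ⟩
    (lo + size (shape l) + 1) + size (shape r) + 1
      ≤⟨ ℕP.+-monoˡ-≤ 1 (ℕP.+-monoˡ-≤ (size (shape r)) (insertionOrder-size-bound ol lo<x)) ⟩
    x + size (shape r) + 1
      ≤⟨ insertionOrder-size-bound or x<hi ⟩
    hi ∎
    where open ℕP.≤-Reasoning

  insertionOrder-inorderLabelled : ∀ {lo hi B W} → InsertionOrder key lo hi B W → hi ≡ lo + size (shape B) + 1 →
    B ≡ inorderLabelled lo (shape B)
  insertionOrder-inorderLabelled leaf _ = refl
  insertionOrder-inorderLabelled {lo} {hi} (node {l = l} {x} {r} refl (lo<x , x<hi) _ ol or) hi≡ = begin
    node l x r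
      ≡⟨ cong₂ (λ l′ r′ → node l′ x r′) (insertionOrder-inorderLabelled ol x≡)
                                         (insertionOrder-inorderLabelled or (trans hi≡′ (cong (λ z → z + sr + 1) (sym x≡)))) ⟩
    node (inorderLabelled lo (shape l)) x (inorderLabelled x (shape r))
      ≡⟨ cong (λ z → node (inorderLabelled lo (shape l)) z (inorderLabelled z (shape r))) x≡ ⟩
    inorderLabelled lo (shape (node l x r)) ∎
    where
    open ≡-Reasoning
    sl sr : ℕ
    sl = size (shape l)
    sr = size (shape r)
    hi≡′ : hi ≡ (lo + sl + 1) + sr + 1
    hi≡′ = trans hi≡ (m+[n+1+o]+1≡m+n+1+o+1 lo sl sr)
    x≤ : x + (sr + 1) ≤ (lo + sl + 1) + (sr + 1)
    x≤ = subst₂ _≤_ (ℕP.+-assoc x sr 1) (trans hi≡′ (ℕP.+-assoc _ sr 1)) (insertionOrder-size-bound or x<hi)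
    x≡ : x ≡ lo + sl + 1
    x≡ = ℕP.≤-antisym (ℕP.+-cancelʳ-≤ (sr + 1) x _ x≤) (insertionOrder-size-bound ol lo<x)

map-proj₂-numbered : ∀ i X → map proj₂ (numbered i X) ≡ X
map-proj₂-numbered i []      = refl
map-proj₂-numbered i (x ∷ X) = cong (x ∷_) (map-proj₂-numbered (suc i) X)

numbered-increasing : ∀ i X → RowsIncreasingFrom (ℤ.+ i) (numbered (suc i) X)
numbered-increasing i []      = tt
numbered-increasing i (x ∷ X) = ℤ.+<+ (ℕP.n<1+n i) , numbered-increasing (suc i) X

initPts-rowsAtMost0 : ∀ o d T → RowsAtMost (ℤ.+ 0) (initPts o d T)
initPts-rowsAtMost0 o d lf       = []
initPts-rowsAtMost0 o d (nd l r) =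
  ℤP.neg-mono-≤ (ℤ.+≤+ ℕ.z≤n) ∷ AllP.++⁺ (initPts-rowsAtMost0 o (suc d) l) (initPts-rowsAtMost0 _ (suc d) r)

GS-keyOrder-invariant : ∀ n T {lo hi B Y Y′} → KeyOrder lo hi B Y → KeyOrder lo hi B Y′ →
  length (GS n T Y) ≡ length (GS n T Y′)
GS-keyOrder-invariant n T {B = B} {Y} {Y′} order order′ = begin
  length (GS n T Y)
    ≡⟨ viaGreedy order ⟩
  length (greedy n (inI B) P (numbered 1 Y))
    ≡⟨ greedy-length-insertionOrder-invariant n (inI B) (intervalsWithin-inI order) (accessOrder order) (accessOrder order′)
         (numbered-increasing 0 Y) (numbered-increasing 0 Y′) identitySynchronised ⟩
  length (greedy n (inI B) (relabelRows id P) (numbered 1 Y′))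
    ≡⟨ cong (λ Q → length (greedy n (inI B) Q (numbered 1 Y′))) (LP.map-id P) ⟩
  length (greedy n (inI B) P (numbered 1 Y′))
    ≡⟨ sym (viaGreedy order′) ⟩
  length (GS n T Y′) ∎
  where
  open ≡-Reasoning
  P : List Point
  P = initPts 0 0 T
  viaGreedy : ∀ {lo hi Z} → KeyOrder lo hi B Z → length (GS n T Z) ≡ length (greedy n (inI B) P (numbered 1 Z))
  viaGreedy {Z = Z} o = cong length (trans (cong (λ t → run n t P 1 Z) (buildBST-keyOrder o)) (run≡greedy n B P 1 Z))
  accessOrder : ∀ {lo hi Z} → KeyOrder lo hi B Z → AccessOrder lo hi B (numbered 1 Z)
  accessOrder {Z = Z} o = insertionOrder-unmap (numbered 1 Z) (subst (KeyOrder _ _ B) (sym (map-proj₂-numbered 1 Z)) o)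
  identitySynchronised : Synchronised id (ℤ.+ 0) (ℤ.+ 0) P
  identitySynchronised = record
    { rowsAtMost  = initPts-rowsAtMost0 0 0 T
    ; rowsAtMost′ = subst (RowsAtMost (ℤ.+ 0)) (sym (LP.map-id P)) (initPts-rowsAtMost0 0 0 T)
    ; embedding   = λ _ _ → id , id
    }

range≡applyUpTo : ∀ n → range n ≡ applyUpTo suc n
range≡applyUpTo zero    = refl
range≡applyUpTo (suc n) = trans (cong (_++ suc n ∷ []) (range≡applyUpTo n)) (LP.applyUpTo-∷ʳ suc n)

length-range : ∀ n → length (range n) ≡ n
length-range n = trans (cong length (range≡applyUpTo n)) (LP.length-applyUpTo suc n)

range-unique : ∀ n → Unique (range n)
range-unique n = subst Unique (sym (range≡applyUpTo n))
  (Unique.applyUpTo⁺₁ suc n λ i<j _ 1+i≡1+j → ℕP.<-irrefl (ℕP.suc-injective 1+i≡1+j) i<j)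

range-within : ∀ n {a} → a ∈ range n → Between 0 (suc n) a
range-within n a∈ with _ , i<n , refl ← ∈-applyUpTo⁻ suc (subst (_ ∈_) (range≡applyUpTo n) a∈) =
  ℕ.s≤s ℕ.z≤n , ℕ.s≤s i<n

keyOrder-of-permutation : ∀ {n X} → X ↭ range n → ∃[ B ] KeyOrder 0 (suc n) B X
keyOrder-of-permutation {n} {X} X↭range = keyOrder-exists (length X) X ℕP.≤-refl
  (Unique-resp-↭ (↭⇒↭ₛ (↭-sym X↭range)) (range-unique n))
  (All.tabulate λ x∈ → range-within n (∈-resp-↭ X↭range x∈))

mainTheorem9 : (n : ℕ) (T : BT) → size T ≡ n → (X : List ℕ) → X ↭ range n →
    ∃[ XR ] (XR ↭ range n
    × (∃[ S ] (size S ≡ n × XR ≡ preorder 0 S))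
    × length (GS n T XR) ≡ length (GS n T X))
mainTheorem9 n T _ X X↭range = preorderKeys B , XR↭range , (shape B , size≡n , XR≡preorder) ,
                               GS-keyOrder-invariant n T (keyOrder-preorder X-order) X-order
  where
  built : ∃[ B ] KeyOrder 0 (suc n) B X
  built = keyOrder-of-permutation X↭range
  B : Tree
  B = proj₁ built
  X-order : KeyOrder 0 (suc n) B X
  X-order = proj₂ built
  XR↭range : preorderKeys B ↭ range n
  XR↭range = ↭-trans (keyOrder-↭-keys (keyOrder-preorder X-order)) (↭-trans (↭-sym (keyOrder-↭-keys X-order)) X↭range)
  size≡n : size (shape B) ≡ n
  size≡n = trans (sym (length-insertionOrder X-order)) (trans (↭-length X↭range) (length-range n))
  XR≡preorder : preorderKeys B ≡ preorder 0 (shape B)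
  XR≡preorder = trans (cong preorderKeys (insertionOrder-inorderLabelled X-order (trans (ℕP.+-comm 1 n) (cong (_+ 1) (sym size≡n)))))
                      (preorderKeys-inorderLabelled 0 (shape B))
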